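{- For every $\phi\in\mathsf{InqML}$, every pseudo-model (in particular every model) $\mathcal M=(W,\Sigma,V)$ and every information state $s\subseteq W$: $\mathcal M,s\models\phi$ if and only if $\mathcal M,t\models\phi$ for all $t\subseteq s$ with $|t|\le \mathrm{fl}(\phi)+1$.
   Context: Fix a set of propositional variables $(p_i)_{i\in I}$. A pseudo-model is a triple $\mathcal M=(W,\Sigma,V)$ where $W$ is a non-empty set, $\Sigma\colon W\to\mathcal P(\mathcal P(W))\setminus\{\emptyset\}$ and $V\colon\{p_i:i\in I\}\to\mathcal P(W)$; it is a model if every $\Sigma(w)$ is downward closed under subsets. Put $\sigma(w):=\bigcup\Sigma(w)$. Formulae of $\mathsf{InqML}$: $\phi::=p_i\mid\bot\mid(\phi\wedge\phi)\mid(\phi\to\phi)\mid(\phi\mathbin{\backslash\!/}\phi)\mid\Box\phi\mid\boxplus\phi$. Support semantics for $s\subseteq W$: $\mathcal M,s\models p_i$ iff $s\subseteq V(p_i)$; $\mathcal M,s\models\bot$ iff $s=\emptyset$; $\wedge$ componentwise; $\mathcal M,s\models\phi\to\psi$ iff for all $t\subseteq s$, $\mathcal M,t\models\phi$ implies $\mathcal M,t\models\psi$; $\mathcal M,s\models\phi\mathbin{\backslash\!/}\psi$ iff $\mathcal M,s\models\phi$ or $\mathcal M,s\models\psi$; $\mathcal M,s\models\Box\phi$ iff $\mathcal M,\sigma(w)\models\phi$ for all $w\in s$; $\mathcal M,s\models\boxplus\phi$ iff $\mathcal M,t\models\phi$ for all $w\in s$, $t\in\Sigma(w)$. The flatness grade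 $\mathrm{fl}(\phi)\in\mathbb N$ is defined by: $\mathrm{fl}(\phi)=0$ if $\phi$ is $p_i$, $\bot$, $\Box\psi$ or $\boxplus\psi$; $\mathrm{fl}(\psi\wedge\chi)=\max\{\mathrm{fl}(\psi),\mathrm{fl}(\chi)\}$; $\mathrm{fl}(\psi\to\chi)=\mathrm{fl}(\chi)$; $\mathrm{fl}(\psi\mathbin{\backslash\!/}\chi)=\mathrm{fl}(\psi)+\mathrm{fl}(\chi)+1$. -}

module Defs where

open import Data.Nat using (ℕ; zero; suc; _+_; _⊔_)
open import Data.Fin using (Fin)
open import Data.Product using (Σ; ∃; _×_; _,_)
open import Data.Sum using (_⊎_)
open import Data.Empty using (⊥)
open import Level using (Lift)
open import Relation.Binary.PropositionalEquality using (_≡_)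

Subset : Set → Set₁
Subset W = W → Set

_⊆_ : {W : Set} → Subset W → Subset W → Set
s ⊆ t = ∀ w → s w → t w

-- |t| ≤ k : there is an injection from (the elements of) t into Fin k.
-- (Injectivity is on the underlying points of W, not on membership proofs.)
HasCardAtMost : {W : Set} → Subset W → ℕ → Set
HasCardAtMost {W} t k =
  Σ ((w : W) → t w → Fin k) λ f →
    ∀ w v (p : t w) (q : t v) → f w p ≡ f v q → w ≡ v

data Formula (I : Set) : Set where
  var  : I → Formula I
  ⊥'   : Formula I
  _∧'_ : Formula I → Formula I → Formula I
  _⇒'_ : Formula I → Formula I → Formula I
  _⩔_  : Formula I → Formula I → Formula I
  □'   : Formula I → Formula I
  ⊞'   : Formula I → Formula I

fl : {I : Set} → Formula I → ℕ
fl (var i)   = 0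
fl ⊥'        = 0
fl (φ ∧' ψ)  = fl φ ⊔ fl ψ
fl (φ ⇒' ψ)  = fl ψ
fl (φ ⩔ ψ)   = fl φ + fl ψ + 1
fl (□' φ)    = 0
fl (⊞' φ)    = 0

record PseudoModel (I : Set) : Set₁ where
  field
    W         : Set
    inhabited : W
    -- Σ(w) is given as a (small) family of subsets of W, indexed by Idx w;
    -- the set Σ(w) is { Σm w i | i : Idx w }.
    Idx       : W → Set
    Σm        : (w : W) → Idx w → Subset W
    Σm-nonempty : ∀ w → Idx w
    V         : I → Subset W

  σ : W → Subset W
  σ w v = ∃ λ (i : Idx w) → Σm w i v

module _ {I : Set} (M : PseudoModel I) where
  open PseudoModel M

  _⊨_ : Subset W → Formula I → Set₁
  s ⊨ var i    = Lift _ (s ⊆ V i)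
  s ⊨ ⊥'       = Lift _ (∀ w → s w → ⊥)
  s ⊨ (φ ∧' ψ) = (s ⊨ φ) × (s ⊨ ψ)
  s ⊨ (φ ⇒' ψ) = ∀ (t : Subset W) → t ⊆ s → t ⊨ φ → t ⊨ ψ
  s ⊨ (φ ⩔ ψ)  = (s ⊨ φ) ⊎ (s ⊨ ψ)
  s ⊨ □' φ     = ∀ w → s w → σ w ⊨ φ
  s ⊨ ⊞' φ     = ∀ w → s w → ∀ (i : Idx w) → Σm w i ⊨ φ

-- Support is persistent (inherited by substates), so only the converse
-- needs work, by induction on φ.  Flat formulae (fl φ = 0) are decided at
-- singletons.  For φ ⩔ ψ, if s supported neither disjunct, classically there
-- would be counterexamples t₁ ⊆ s for φ and t₂ ⊆ s for ψ with at most
-- fl φ + 1 and fl ψ + 1 points; their union has at most fl (φ ⩔ ψ) + 1 points,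
-- so it supports φ or ψ, and by persistence so does t₁ resp. t₂.
module Submission where

open import Defs
open import Data.Nat using (ℕ; _+_; _≤_)
open import Axiom.ExcludedMiddle using (ExcludedMiddle)
open import Level using (0ℓ; _⊔_; suc; lift; lower)
open import Data.Nat.Properties using (m≤m⊔n; m≤n⊔m; m≤n+m; +-monoˡ-≤; ≤-reflexive)
open import Data.Nat.Tactic.RingSolver using (solve-∀)
open import Data.Fin using (Fin; inject≤; join; splitAt)
open import Data.Fin.Properties using (inject≤-injective; splitAt-join)
open import Data.Product using (_×_; ∃; _,_; proj₁; proj₂)
open import Data.Sum using (_⊎_; inj₁; inj₂; [_,_])
import Data.Sum as Sum
open import Data.Sum.Properties using (inj₁-injective; inj₂-injective)
open import Data.Empty using (⊥-elim)
open import Relation.Nullary using (¬_; yes; no)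
open import Function using (_∘_)
open import Relation.Unary using (｛_｝; _∪_)
open import Relation.Binary.PropositionalEquality using (_≡_; refl; sym; cong; module ≡-Reasoning)

¬∀⇒∃¬ : ∀ {a q p} {A : Set a} {Q : A → Set q} {P : A → Set p}
  → ExcludedMiddle (a ⊔ q ⊔ p) → ExcludedMiddle p
  → ¬ (∀ x → Q x → P x) → ∃ λ x → Q x × ¬ P x
¬∀⇒∃¬ {Q = Q} {P} em em′ ¬∀ with em {∃ λ x → Q x × ¬ P x}
... | yes ∃¬ = ∃¬
... | no ¬∃¬ = ⊥-elim (¬∀ stable-P)
  where
  stable-P : ∀ x → Q x → P x
  stable-P x Qx with em′ {P x}
  ... | yes Px = Px
  ... | no ¬Px = ⊥-elim (¬∃¬ (x , Qx , ¬Px))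

+1-+-+1 : ∀ m n → m + 1 + (n + 1) ≡ m + n + 1 + 1
+1-+-+1 = solve-∀

join-injective : ∀ m n {i j : Fin m ⊎ Fin n} → join m n i ≡ join m n j → i ≡ j
join-injective m n {i} {j} e = begin
  i                       ≡⟨ sym (splitAt-join m n i) ⟩
  splitAt m (join m n i)  ≡⟨ cong (splitAt m) e ⟩
  splitAt m (join m n j)  ≡⟨ splitAt-join m n j ⟩
  j                       ∎
  where open ≡-Reasoning

module _ {W : Set} where

  HasCardAtMost-mono : {t : Subset W} {m n : ℕ} → m ≤ n
    → HasCardAtMost t m → HasCardAtMost t n
  HasCardAtMost-mono m≤n (f , f-inj) =
    (λ w p → inject≤ (f w p) m≤n) ,
    (λ w v p q e → f-inj w v p q (inject≤-injective m≤n m≤n _ _ e))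

  HasCardAtMost-｛｝ : (w : W) → HasCardAtMost ｛ w ｝ 1
  HasCardAtMost-｛｝ w = (λ _ _ → Fin.zero) , λ { u v refl refl _ → refl }

  HasCardAtMost-∪ : {t₁ t₂ : Subset W} {m n : ℕ}
    → HasCardAtMost t₁ m → HasCardAtMost t₂ n → HasCardAtMost (t₁ ∪ t₂) (m + n)
  HasCardAtMost-∪ {t₁} {t₂} {m} {n} (f , f-inj) (g , g-inj) = h , h-inj
    where
    h : ∀ w → (t₁ ∪ t₂) w → Fin (m + n)
    h w = join m n ∘ Sum.map (f w) (g w)

    h-inj : ∀ w v p q → h w p ≡ h v q → w ≡ v
    h-inj w v (inj₁ p) (inj₁ q) e = f-inj w v p q (inj₁-injective (join-injective m n e))
    h-inj w v (inj₁ p) (inj₂ q) e with () ← join-injective m n {inj₁ (f w p)} {inj₂ (g v q)} e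
    h-inj w v (inj₂ p) (inj₁ q) e with () ← join-injective m n {inj₂ (g w p)} {inj₁ (f v q)} e
    h-inj w v (inj₂ p) (inj₂ q) e = g-inj w v p q (inj₂-injective (join-injective m n e))

module _ {I : Set} (M : PseudoModel I) where
  open PseudoModel M

  infix 4 _⊨ᴹ_
  _⊨ᴹ_ : Subset W → Formula I → Set₁
  _⊨ᴹ_ = _⊨_ M

  ⊨-persistent : (φ : Formula I) {s t : Subset W} → t ⊆ s → s ⊨ᴹ φ → t ⊨ᴹ φ
  ⊨-persistent (var i)  t⊆s (lift s⊆V) = lift λ w p → s⊆V w (t⊆s w p)
  ⊨-persistent ⊥'       t⊆s (lift s=∅) = lift λ w p → s=∅ w (t⊆s w p)
  ⊨-persistent (φ ∧' ψ) t⊆s (sφ , sψ)  = ⊨-persistent φ t⊆s sφ , ⊨-persistent ψ t⊆s sψ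
  ⊨-persistent (φ ⇒' ψ) t⊆s s⊨φ⇒ψ      = λ u u⊆t → s⊨φ⇒ψ u λ w p → t⊆s w (u⊆t w p)
  ⊨-persistent (φ ⩔ ψ)  t⊆s (inj₁ sφ)  = inj₁ (⊨-persistent φ t⊆s sφ)
  ⊨-persistent (φ ⩔ ψ)  t⊆s (inj₂ sψ)  = inj₂ (⊨-persistent ψ t⊆s sψ)
  ⊨-persistent (□' φ)   t⊆s s⊨□φ       = λ w p → s⊨□φ w (t⊆s w p)
  ⊨-persistent (⊞' φ)   t⊆s s⊨⊞φ       = λ w p → s⊨⊞φ w (t⊆s w p)

  SmallSubstatesSupport : Formula I → Subset W → Set₁
  SmallSubstatesSupport φ s =
    (t : Subset W) → t ⊆ s → HasCardAtMost t (fl φ + 1) → t ⊨ᴹ φ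

  ｛｝⊆ : {s : Subset W} {w : W} → s w → ｛ w ｝ ⊆ s
  ｛｝⊆ p _ refl = p

  singletons-support : ∀ φ {s} → SmallSubstatesSupport φ s → ∀ {w} → s w → ｛ w ｝ ⊨ᴹ φ
  singletons-support φ small p = small ｛ _ ｝ (｛｝⊆ p) (HasCardAtMost-mono (m≤n+m 1 (fl φ)) (HasCardAtMost-｛｝ _))

  module _ (em : ExcludedMiddle (suc 0ℓ)) where

    small-counterexample : ∀ φ {s} → (SmallSubstatesSupport φ s → s ⊨ᴹ φ) → ¬ s ⊨ᴹ φ
      → ∃ λ t → (t ⊆ s × HasCardAtMost t (fl φ + 1)) × ¬ t ⊨ᴹ φ
    small-counterexample φ local ¬sφ =
      ¬∀⇒∃¬ em em λ small → ¬sφ (local λ t t⊆s c → small t (t⊆s , c))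

    ⩔-from-small : ∀ φ ψ {s}
      → (SmallSubstatesSupport φ s → s ⊨ᴹ φ) → (SmallSubstatesSupport ψ s → s ⊨ᴹ ψ)
      → SmallSubstatesSupport (φ ⩔ ψ) s → s ⊨ᴹ φ ⩔ ψ
    ⩔-from-small φ ψ {s} localφ localψ small with em {s ⊨ᴹ φ} | em {s ⊨ᴹ ψ}
    ... | yes sφ | _      = inj₁ sφ
    ... | no _   | yes sψ = inj₂ sψ
    ... | no ¬sφ | no ¬sψ
      with small-counterexample φ localφ ¬sφ | small-counterexample ψ localψ ¬sψ
    ... | t₁ , (t₁⊆s , c₁) , ¬t₁φ | t₂ , (t₂⊆s , c₂) , ¬t₂ψ
      with small (t₁ ∪ t₂) (λ w → [ t₁⊆s w , t₂⊆s w ])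
                 (HasCardAtMost-mono (≤-reflexive (+1-+-+1 (fl φ) (fl ψ))) (HasCardAtMost-∪ c₁ c₂))
    ... | inj₁ t₁∪t₂φ = ⊥-elim (¬t₁φ (⊨-persistent φ (λ _ → inj₁) t₁∪t₂φ))
    ... | inj₂ t₁∪t₂ψ = ⊥-elim (¬t₂ψ (⊨-persistent ψ (λ _ → inj₂) t₁∪t₂ψ))

    ⊨-from-small : ∀ φ {s} → SmallSubstatesSupport φ s → s ⊨ᴹ φ
    ⊨-from-small (var i)  small = lift λ w p → lower (singletons-support (var i) small p) w refl
    ⊨-from-small ⊥'       small = lift λ w p → lower (singletons-support ⊥' small p) w refl
    ⊨-from-small (□' φ)   small = λ w p → singletons-support (□' φ) small p w refl
    ⊨-from-small (⊞' φ)   small = λ w p → singletons-support (⊞' φ) small p w refl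
    ⊨-from-small (φ ∧' ψ) small =
        ⊨-from-small φ (λ t t⊆s c → proj₁ (small t t⊆s (enlarge (m≤m⊔n (fl φ) (fl ψ)) c)))
      , ⊨-from-small ψ (λ t t⊆s c → proj₂ (small t t⊆s (enlarge (m≤n⊔m (fl φ) (fl ψ)) c)))
      where
      enlarge : ∀ {t : Subset W} {m n} → m ≤ n → HasCardAtMost t (m + 1) → HasCardAtMost t (n + 1)
      enlarge m≤n = HasCardAtMost-mono (+-monoˡ-≤ 1 m≤n)
    ⊨-from-small (φ ⇒' ψ) small = λ t t⊆s tφ →
      ⊨-from-small ψ λ u u⊆t c → small u (λ w p → t⊆s w (u⊆t w p)) c u (λ _ p → p) (⊨-persistent φ u⊆t tφ)
    ⊨-from-small (φ ⩔ ψ)  small = ⩔-from-small φ ψ (⊨-from-small φ) (⊨-from-small ψ) small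

proposition3p7 : ExcludedMiddle 0ℓ → ExcludedMiddle (Level.suc 0ℓ) → {I : Set} → (φ : Formula I) → (M : PseudoModel I)
    → (s : Subset (PseudoModel.W M))
    → ((_⊨_ M s φ → ((t : Subset (PseudoModel.W M)) → t ⊆ s → HasCardAtMost t (fl φ + 1) → _⊨_ M t φ))
    × (((t : Subset (PseudoModel.W M)) → t ⊆ s → HasCardAtMost t (fl φ + 1) → _⊨_ M t φ) → _⊨_ M s φ))
proposition3p7 _ em φ M s =
  (λ sφ t t⊆s _ → ⊨-persistent M φ t⊆s sφ) , ⊨-from-small M em φ
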